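{- Let $n$ be a positive integer and let $\mathcal{M}_0(n)=\{M\in\mathcal{M}_0 : \ell(M)\le n\}$. There is a one-to-one correspondence between the unrestricted partitions of $n$ into at least two parts and the elements of $\mathcal{M}_0(n)$.
   Context: $\mathcal{M}$ is the set of all two-line matrices $M=\begin{pmatrix} c_1 & \cdots & c_s\\ d_1 & \cdots & d_s\end{pmatrix}$ ($s\ge1$) with non-negative integer entries satisfying $c_s=0$, $d_s\ne0$, and $c_j=c_{j+1}+d_{j+1}$ for $1\le j\le s-1$; $\mathcal{M}_0$ is the subset of those with $d_1=0$. $\ell(M)$ denotes the sum of all entries of $M$. -}

module Defs where

open import Data.Nat using (ℕ; _+_; _≤_; _<_; _≥_)
open import Data.Product using (_×_; _,_; Σ; ∃)
open import Data.List using (List; map; length; head; last)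
open import Data.Nat.ListAction using (sum)
open import Data.Maybe using (just)
open import Data.List.Relation.Unary.All using (All)
open import Data.List.Relation.Unary.Linked using (Linked)
open import Relation.Binary.PropositionalEquality using (_≡_)

record PartitionAtLeast2 (n : ℕ) : Set where
  constructor mkPart
  field
    parts      : List ℕ
    positive   : All (λ p → 0 < p) parts
    decreasing : Linked _≥_ parts
    sums       : sum parts ≡ n
    twoParts   : 2 ≤ length parts

-- A two-line matrix is represented by its list of columns (c_j , d_j).
Column : Set
Column = ℕ × ℕ

ColStep : Column → Column → Set
ColStep (c , _) (c′ , d′) = c ≡ c′ + d′

ℓ : List Column → ℕ
ℓ cols = sum (map (λ { (c , d) → c + d }) cols)

-- Membership in 𝓜 (s ≥ 1 is implied by last being defined):
-- last column is (0 , d) with d ≠ 0, and c_j = c_{j+1} + d_{j+1}.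
record IsM (cols : List Column) : Set where
  field
    lastCol : Σ ℕ λ d → (last cols ≡ just (0 , d)) × (0 < d)
    steps   : Linked ColStep cols

record IsM₀ (cols : List Column) : Set where
  field
    isM      : IsM cols
    firstCol : Σ ℕ λ c → head cols ≡ just (c , 0)

record M₀ (n : ℕ) : Set where
  constructor mkM₀
  field
    cols  : List Column
    isM₀  : IsM₀ cols
    bound : ℓ cols ≤ n

module Submission where

-- Call c + d the height of a column (c , d).  The chain condition
-- c_j = c_{j+1} + d_{j+1} says that the top entry of every column is the
-- height of the next one, so a matrix of 𝓜 is determined by its list of
-- heights h_1 ≥ ⋯ ≥ h_s > 0: it is the staircase with columns
-- (h_{j+1} , h_j − h_{j+1}) and last column (0 , h_s), and ℓ(M) is the sum
-- of the heights.  The extra condition d_1 = 0 of 𝓜₀ says h_1 = h_2.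
-- Hence a partition a_1 ≥ a_2 ≥ ⋯ ≥ a_k (k ≥ 2) of n corresponds to the
-- matrix with heights a_2 , a_2 , a_3 , … , a_k (so ℓ = n − (a_1 − a_2) ≤ n),
-- and the partition is recovered by raising the first height by n − ℓ(M).

open import Defs
open import Data.Nat using (ℕ; _≤_; _+_; _∸_; _<_; _≥_; z≤n; s≤s)
open import Data.Nat.Properties
open import Data.Product using (_×_; _,_; Σ)
open import Data.List using (List; []; _∷_; map; length; head; last)
open import Data.Nat.ListAction using (sum)
open import Data.Maybe using (Maybe; just)
open import Data.List.Relation.Unary.All as All using (All; []; _∷_)
open import Data.List.Relation.Unary.Linked as Linked using (Linked; []; [-]; _∷_)
open import Relation.Binary.PropositionalEquality
open import Function.Bundles using (_⤖_; mk↔ₛ′)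
open import Function.Base using (_∋_)
open import Function.Properties.Inverse using (↔⇒⤖)
open import Axiom.UniquenessOfIdentityProofs using (module Decidable⇒UIP)
import Data.Maybe.Properties as Maybe
import Data.Product.Properties as Product

partition-≡ : ∀ {n} {P Q : PartitionAtLeast2 n} →
              PartitionAtLeast2.parts P ≡ PartitionAtLeast2.parts Q → P ≡ Q
partition-≡ {P = mkPart l pos dec sums two} {mkPart .l pos′ dec′ sums′ two′} refl
  rewrite All.irrelevant <-irrelevant pos pos′
        | Linked.irrelevant ≤-irrelevant dec dec′
        | ≡-irrelevant sums sums′
        | ≤-irrelevant two two′ = refl

maybeColumn-uip : {a b : Maybe Column} (p q : a ≡ b) → p ≡ q
maybeColumn-uip = Decidable⇒UIP.≡-irrelevant (Maybe.≡-dec (Product.≡-dec _≟_ _≟_))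

column-injective : {x y : Column} → (Maybe Column ∋ just x) ≡ just y → x ≡ y
column-injective = Maybe.just-injective

lastCol-irrelevant : ∀ {cols} (x y : Σ ℕ λ d → (last cols ≡ just (0 , d)) × (0 < d)) → x ≡ y
lastCol-irrelevant (d , last≡ , 0<d) (d′ , last≡′ , 0<d′)
  with column-injective (trans (sym last≡) last≡′)
... | refl rewrite maybeColumn-uip last≡ last≡′ | <-irrelevant 0<d 0<d′ = refl

firstCol-irrelevant : ∀ {cols} (x y : Σ ℕ λ c → head cols ≡ just (c , 0)) → x ≡ y
firstCol-irrelevant (c , head≡) (c′ , head≡′)
  with column-injective (trans (sym head≡) head≡′)
... | refl rewrite maybeColumn-uip head≡ head≡′ = refl

isM₀-irrelevant : ∀ {cols} (i j : IsM₀ cols) → i ≡ j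
isM₀-irrelevant {cols} i j =
  cong₂ (λ l f → record { isM = l ; firstCol = f })
    (cong₂ (λ l s → record { lastCol = l ; steps = s })
       (lastCol-irrelevant {cols} (IsM.lastCol (IsM₀.isM i)) (IsM.lastCol (IsM₀.isM j)))
       (Linked.irrelevant ≡-irrelevant (IsM.steps (IsM₀.isM i)) (IsM.steps (IsM₀.isM j))))
    (firstCol-irrelevant {cols} (IsM₀.firstCol i) (IsM₀.firstCol j))

m₀-≡ : ∀ {n} {M N : M₀ n} → M₀.cols M ≡ M₀.cols N → M ≡ N
m₀-≡ {M = mkM₀ cols i bound} {mkM₀ .cols j bound′} refl =
  cong₂ (mkM₀ cols) (isM₀-irrelevant i j) (≤-irrelevant bound bound′)

height : Column → ℕ
height (c , d) = c + d

heights : List Column → List ℕ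
heights = map height

ℓ-heights : ∀ cols → ℓ cols ≡ sum (heights cols)
ℓ-heights []              = refl
ℓ-heights ((c , d) ∷ cols) = cong (c + d +_) (ℓ-heights cols)

stairs : ℕ → List ℕ → List Column
stairs x []      = (0 , x) ∷ []
stairs x (y ∷ t) = (y , x ∸ y) ∷ stairs y t

heights-stairs : ∀ {x t} → Linked _≥_ (x ∷ t) → heights (stairs x t) ≡ x ∷ t
heights-stairs [-]          = refl
heights-stairs (y≤x ∷ decr) = cong₂ _∷_ (m+[n∸m]≡n y≤x) (heights-stairs decr)

stairs-heights : ∀ {c d cols d′} → Linked ColStep ((c , d) ∷ cols) →
                 last ((c , d) ∷ cols) ≡ just (0 , d′) →
                 stairs (c + d) (heights cols) ≡ (c , d) ∷ cols
stairs-heights {cols = []} [-] refl = refl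
stairs-heights {c} {d} {(c′ , d′) ∷ cols} (c≡ ∷ steps) last≡ =
  cong₂ _∷_ (cong₂ _,_ (sym c≡) bottom) (stairs-heights steps last≡)
  where
    bottom : c + d ∸ (c′ + d′) ≡ d
    bottom = trans (cong (λ h → c + d ∸ h) (sym c≡)) (m+n∸m≡n c d)

stairs-steps : ∀ {x t} d → Linked _≥_ (x ∷ t) → Linked ColStep ((x , d) ∷ stairs x t)
stairs-steps d [-]          = refl ∷ [-]
stairs-steps d (y≤x ∷ decr) = sym (m+[n∸m]≡n y≤x) ∷ stairs-steps _ decr

stairs-last : ∀ col x t → All (0 <_) (x ∷ t) →
              Σ ℕ λ d → (last (col ∷ stairs x t) ≡ just (0 , d)) × (0 < d)
stairs-last col x []      (0<x ∷ _) = x , refl , 0<x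
stairs-last col x (y ∷ t) (_ ∷ pos) = stairs-last (y , x ∸ y) y t pos

step-height : ∀ col col′ → ColStep col col′ → height col′ ≤ height col
step-height (c , d) (_ , _) c≡ = ≤-trans (≤-reflexive (sym c≡)) (m≤m+n c d)

heights-decreasing : ∀ {cols} → Linked ColStep cols → Linked _≥_ (heights cols)
heights-decreasing []  = []
heights-decreasing [-] = [-]
heights-decreasing {col ∷ col′ ∷ _} (c≡ ∷ steps) = step-height col col′ c≡ ∷ heights-decreasing steps

heights-positive : ∀ {cols d} → Linked ColStep cols → last cols ≡ just (0 , d) → 0 < d →
                   All (0 <_) (heights cols)
heights-positive {_ ∷ []} [-] refl 0<d = 0<d ∷ []
heights-positive {col ∷ col′ ∷ _} (c≡ ∷ steps) last≡ 0<d
  with heights-positive steps last≡ 0<d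
... | 0<h ∷ pos = <-≤-trans 0<h (step-height col col′ c≡) ∷ 0<h ∷ pos

raiseHead : ℕ → List ℕ → List ℕ
raiseHead k []      = []
raiseHead k (x ∷ t) = k + x ∷ t

raiseHead-decreasing : ∀ {k xs} → Linked _≥_ xs → Linked _≥_ (raiseHead k xs)
raiseHead-decreasing []                   = []
raiseHead-decreasing [-]                  = [-]
raiseHead-decreasing {k} {x ∷ _} (y≤x ∷ decr) = ≤-trans y≤x (m≤n+m x k) ∷ decr

raiseHead-positive : ∀ {k xs} → All (0 <_) xs → All (0 <_) (raiseHead k xs)
raiseHead-positive []                       = []
raiseHead-positive {k} {x ∷ _} (0<x ∷ pos) = <-≤-trans 0<x (m≤n+m x k) ∷ pos

raiseHead-sum : ∀ k x t → sum (raiseHead k (x ∷ t)) ≡ k + sum (x ∷ t)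
raiseHead-sum k x t = +-assoc k x (sum t)

raiseHead-restores : ∀ {a b} s t → b ≤ a → raiseHead (a + s ∸ (b + s)) (b ∷ t) ≡ a ∷ t
raiseHead-restores {a} {b} s t b≤a = cong (_∷ t) (begin
  a + s ∸ (b + s) + b ≡⟨ cong (_+ b) (cong₂ _∸_ (+-comm a s) (+-comm b s)) ⟩
  s + a ∸ (s + b) + b ≡⟨ cong (_+ b) ([m+n]∸[m+o]≡n∸o s a b) ⟩
  a ∸ b + b           ≡⟨ m∸n+n≡m b≤a ⟩
  a                   ∎)
  where open ≡-Reasoning

matrixOf : List ℕ → List Column
matrixOf (_ ∷ b ∷ t) = (b , 0) ∷ stairs b t
matrixOf _           = []

partitionOf : ℕ → List Column → List ℕ
partitionOf n cols = raiseHead (n ∸ ℓ cols) (heights cols)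

heights-matrixOf : ∀ {a b t} → Linked _≥_ (a ∷ b ∷ t) →
                   heights (matrixOf (a ∷ b ∷ t)) ≡ b ∷ b ∷ t
heights-matrixOf {b = b} (_ ∷ decr) = cong₂ _∷_ (+-identityʳ b) (heights-stairs decr)

ℓ-matrixOf : ∀ {a b t} → Linked _≥_ (a ∷ b ∷ t) → ℓ (matrixOf (a ∷ b ∷ t)) ≡ sum (b ∷ b ∷ t)
ℓ-matrixOf {a} {b} {t} decr = trans (ℓ-heights (matrixOf (a ∷ b ∷ t))) (cong sum (heights-matrixOf decr))

matrixOf-isM₀ : ∀ {parts} → All (0 <_) parts → Linked _≥_ parts → 2 ≤ length parts →
                IsM₀ (matrixOf parts)
matrixOf-isM₀ {_ ∷ b ∷ t} (_ ∷ pos) (_ ∷ decr) _ = record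
  { isM      = record { lastCol = stairs-last (b , 0) b t pos ; steps = stairs-steps 0 decr }
  ; firstCol = b , refl }
matrixOf-isM₀ {_ ∷ []} _ _ (s≤s ())

matrixOf-bound : ∀ {n parts} → Linked _≥_ parts → sum parts ≡ n → 2 ≤ length parts →
                 ℓ (matrixOf parts) ≤ n
matrixOf-bound {parts = a ∷ b ∷ t} decr@(b≤a ∷ _) sums _ = begin
  ℓ (matrixOf (a ∷ b ∷ t)) ≡⟨ ℓ-matrixOf decr ⟩
  b + sum (b ∷ t)          ≤⟨ +-monoˡ-≤ (sum (b ∷ t)) b≤a ⟩
  a + sum (b ∷ t)          ≡⟨ sums ⟩
  _                        ∎
  where open ≤-Reasoning
matrixOf-bound {parts = _ ∷ []} _ _ (s≤s ())

data M₀Chain : List Column → Set where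
  chain : ∀ {c c′ d′ cols d} → ColStep (c , 0) (c′ , d′) →
          Linked ColStep ((c′ , d′) ∷ cols) → last ((c′ , d′) ∷ cols) ≡ just (0 , d) →
          M₀Chain ((c , 0) ∷ (c′ , d′) ∷ cols)

-- A one-column matrix (0 , d) has d ≠ 0, so it is never in 𝓜₀.
m₀-chain : ∀ {cols} → IsM₀ cols → M₀Chain cols
m₀-chain {[]} record { isM = record { lastCol = _ , () , _ } }
m₀-chain {_ ∷ []} record { isM = record { lastCol = _ , refl , () } ; firstCol = _ , refl }
m₀-chain {_ ∷ _ ∷ _} record { isM = record { lastCol = _ , last≡ , _ ; steps = c≡ ∷ steps }
                            ; firstCol = _ , refl } = chain c≡ steps last≡

partitionOf-positive : ∀ {n cols} → IsM cols → All (0 <_) (partitionOf n cols)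
partitionOf-positive record { lastCol = _ , last≡ , 0<d ; steps = steps } =
  raiseHead-positive (heights-positive steps last≡ 0<d)

partitionOf-decreasing : ∀ {n cols} → IsM cols → Linked _≥_ (partitionOf n cols)
partitionOf-decreasing record { steps = steps } = raiseHead-decreasing (heights-decreasing steps)

partitionOf-sum : ∀ {n cols} → M₀Chain cols → ℓ cols ≤ n → sum (partitionOf n cols) ≡ n
partitionOf-sum {n} {cols@(col ∷ rest)} (chain _ _ _) bound = begin
  sum (partitionOf n cols)              ≡⟨ raiseHead-sum (n ∸ ℓ cols) (height col) (heights rest) ⟩
  (n ∸ ℓ cols) + sum (heights cols)     ≡⟨ cong ((n ∸ ℓ cols) +_) (sym (ℓ-heights cols)) ⟩
  (n ∸ ℓ cols) + ℓ cols                 ≡⟨ m∸n+n≡m bound ⟩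
  n                                     ∎
  where open ≡-Reasoning

partitionOf-length : ∀ {n cols} → M₀Chain cols → 2 ≤ length (partitionOf n cols)
partitionOf-length (chain _ _ _) = s≤s (s≤s z≤n)

partitionOf-matrixOf : ∀ {n parts} → Linked _≥_ parts → sum parts ≡ n → 2 ≤ length parts →
                       partitionOf n (matrixOf parts) ≡ parts
partitionOf-matrixOf {parts = a ∷ b ∷ t} decr@(b≤a ∷ _) refl _ = begin
  raiseHead (a + s ∸ ℓ M) (heights M)      ≡⟨ cong₂ (λ l h → raiseHead (a + s ∸ l) h)
                                                    (ℓ-matrixOf decr) (heights-matrixOf decr) ⟩
  raiseHead (a + s ∸ (b + s)) (b ∷ b ∷ t)  ≡⟨ raiseHead-restores s (b ∷ t) b≤a ⟩
  a ∷ b ∷ t                                 ∎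
  where
    open ≡-Reasoning
    s = sum (b ∷ t)
    M = matrixOf (a ∷ b ∷ t)
partitionOf-matrixOf {parts = _ ∷ []} _ _ (s≤s ())

matrixOf-partitionOf : ∀ {n cols} → M₀Chain cols → matrixOf (partitionOf n cols) ≡ cols
matrixOf-partitionOf (chain c≡ steps last≡) =
  cong₂ _∷_ (cong (_, 0) (sym c≡)) (stairs-heights steps last≡)

toM₀ : ∀ {n} → PartitionAtLeast2 n → M₀ n
toM₀ (mkPart parts pos decr sums two) =
  mkM₀ (matrixOf parts) (matrixOf-isM₀ pos decr two) (matrixOf-bound decr sums two)

fromM₀ : ∀ {n} → M₀ n → PartitionAtLeast2 n
fromM₀ {n} (mkM₀ cols i bound) = mkPart (partitionOf n cols)
  (partitionOf-positive (IsM₀.isM i)) (partitionOf-decreasing (IsM₀.isM i))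
  (partitionOf-sum (m₀-chain i) bound) (partitionOf-length (m₀-chain i))

-- The theorem: toM₀ and fromM₀ are mutually inverse.
lemma3p5 : (n : ℕ) → 1 ≤ n → PartitionAtLeast2 n ⤖ M₀ n
lemma3p5 n _ = ↔⇒⤖ (mk↔ₛ′ toM₀ fromM₀
  (λ { (mkM₀ _ i _) → m₀-≡ (matrixOf-partitionOf {n} (m₀-chain i)) })
  (λ { (mkPart _ _ decr sums two) → partition-≡ (partitionOf-matrixOf decr sums two) }))
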